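{- Let $F$ be a generalised clause-set and $v$ a singular variable w.r.t. $F$. Then $F$ is minimally unsatisfiable if and only if $v$ is a non-degenerated DP-variable w.r.t. $F$ and $\mathrm{DP}_v(F)$ is minimally unsatisfiable.
   Context: Each variable $v$ has a finite non-empty domain $D_v$; a literal is a pair $(v,\varepsilon)$, $\varepsilon\in D_v$, meaning "$v\ne\varepsilon$"; a clause is a finite set of literals with no two distinct literals on the same variable; a clause-set is a finite set of clauses. $F$ is minimally unsatisfiable if it is unsatisfiable but every proper subset is satisfiable. $\#_{(v,\varepsilon)}(F)$ is the number of clauses of $F$ containing $(v,\varepsilon)$; $c(F)=|F|$. $v$ is pure for $F$ if some $\varepsilon\in D_v$ has $\#_{(v,\varepsilon)}(F)=0$. Resolution on $v$: clauses $C_1,\dots,C_{|D_v|}$ of $F$ such that every $\varepsilon\in D_v$ occurs as $(v,\varepsilon)$ in some $C_i$ and $\bigcup_i\{x\in C_i:\mathrm{var}(x)\neq v\}$ is a clause (no clash); this union is the resolvent. $\mathrm{DP}_v(F)$ is the set of clauses of $F$ not containing $v$ together with all resolvents on $v$ of clauses of $F$. Always $c(\mathrm{DP}_v(F))\le c(F)-\sum_{\varepsilon\in D_v}\#_{(v,\varepsilon)}(F)+\prod_{\varepsilon\in D_v}\#_{(v,\varepsilon)}(F)$; $v$ is a degenerated DP-variable w.r.t. $F$ if this inequality is strict or $v$ is pure, and non-degenerated otherwise. $v$ is singular w.r.t. $F$ if there is $\varepsilon\in D_v$ with $\#_{(v,\varepsilon')}(F)=1$ for all $\varepsilon'\in D_v\setminus\{\varepsilon\}$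 and $\#_{(v,\varepsilon)}(F)\ge1$. -}

module Defs where

open import Data.Nat using (ℕ; _+_; _<_; _≤_)
import Data.Nat as ℕ
open import Data.Fin using (Fin; toℕ)
open import Data.Product using (Σ; ∃; ∃-syntax; _×_; _,_; proj₁; proj₂)
open import Data.Product.Properties using (≡-dec)
open import Data.Sum using (_⊎_)
open import Data.List using (List; length; filter; map; upTo)
open import Data.Nat.ListAction using (sum; product)
open import Data.List.Relation.Unary.All using (All)
open import Data.List.Relation.Unary.Any using (Any)
open import Data.List.Relation.Unary.AllPairs using (AllPairs)
open import Data.List.Membership.Propositional using (_∈_; _∉_)
open import Relation.Binary.PropositionalEquality using (_≡_; _≢_)
open import Relation.Binary.Definitions using (DecidableEquality)
open import Relation.Nullary using (¬_)
open import Function.Bundles using (_⇔_)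
import Data.List.Membership.DecPropositional as DecMem

-- A domain assignment `dom` gives the
-- size of the finite domain of each variable; the domain of v is
-- D_v = {0, …, dom v - 1}.

Domains : Set
Domains = ℕ → ℕ

Var : Set
Var = ℕ

-- literal (v , ε) means "v ≠ ε"
Lit : Set
Lit = ℕ × ℕ

var : Lit → Var
var = proj₁

_≟L_ : DecidableEquality Lit
_≟L_ = ≡-dec ℕ._≟_ ℕ._≟_

open DecMem _≟L_ using (_∈?_)

-- A clause is represented by a list of literals; only the underlying
-- set matters (duplicates are harmless, clauses are compared by ≋).
Clause : Set
Clause = List Lit

_≋_ : Clause → Clause → Set
C ≋ D = ∀ x → (x ∈ C) ⇔ (x ∈ D)

IsClause : Domains → Clause → Set
IsClause dom C =
  (∀ x → x ∈ C → proj₂ x < dom (var x)) ×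
  (∀ x y → x ∈ C → y ∈ C → var x ≡ var y → x ≡ y)

ClauseSet : Set
ClauseSet = List Clause

IsClauseSet : Domains → ClauseSet → Set
IsClauseSet dom F = All (IsClause dom) F × AllPairs (λ C D → ¬ (C ≋ D)) F

c : ClauseSet → ℕ
c = length

Assignment : Domains → Set
Assignment dom = (v : Var) → Fin (dom v)

SatLit : {dom : Domains} → Assignment dom → Lit → Set
SatLit φ (v , ε) = toℕ (φ v) ≢ ε

SatClause : {dom : Domains} → Assignment dom → Clause → Set
SatClause φ C = Any (SatLit φ) C

Satisfiable : Domains → ClauseSet → Set
Satisfiable dom F = Σ (Assignment dom) λ φ → All (SatClause φ) F

MU : Domains → ClauseSet → Set
MU dom F =
  ¬ Satisfiable dom F ×
  (∀ (G : ClauseSet) → (∀ C → C ∈ G → C ∈ F) → (∃[ C ] (C ∈ F × C ∉ G)) →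
     Satisfiable dom G)

occ : Lit → ClauseSet → ℕ
occ x F = length (filter (λ C → x ∈? C) F)

occSum : Domains → Var → ClauseSet → ℕ
occSum dom v F = sum (map (λ ε → occ (v , ε) F) (upTo (dom v)))

occProd : Domains → Var → ClauseSet → ℕ
occProd dom v F = product (map (λ ε → occ (v , ε) F) (upTo (dom v)))

Pure : Domains → Var → ClauseSet → Set
Pure dom v F = ∃[ ε ] (ε < dom v × occ (v , ε) F ≡ 0)

Singular : Domains → Var → ClauseSet → Set
Singular dom v F =
  ∃[ ε ] (ε < dom v × 1 ≤ occ (v , ε) F ×
          (∀ ε′ → ε′ < dom v → ε′ ≢ ε → occ (v , ε′) F ≡ 1))

Occurs : Var → Clause → Set
Occurs v C = Any (λ x → var x ≡ v) C

IsResolvent : Domains → Var → ClauseSet → Clause → Set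
IsResolvent dom v F R =
  Σ (Fin (dom v) → Clause) λ Cs →
    (∀ i → Cs i ∈ F) ×
    (∀ ε → ε < dom v → ∃[ i ] ((v , ε) ∈ Cs i)) ×
    (∀ x → (x ∈ R) ⇔ (∃[ i ] (x ∈ Cs i × var x ≢ v))) ×
    IsClause dom R

IsDP : Domains → Var → ClauseSet → ClauseSet → Set
IsDP dom v F G =
  IsClauseSet dom G ×
  (∀ C → (Any (λ D → C ≋ D) G) ⇔
         ((∃[ D ] (D ∈ F × ¬ Occurs v D × C ≋ D)) ⊎ IsResolvent dom v F C))

-- degenerated / non-degenerated DP-variable, given G = DP_v(F).
-- "c(G) < c(F) - Σ + ∏" is written without truncated subtraction.
Degenerated : Domains → Var → ClauseSet → ClauseSet → Set
Degenerated dom v F G =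
  Pure dom v F ⊎ (c G + occSum dom v F < c F + occProd dom v F)

NonDegenerated : Domains → Var → ClauseSet → ClauseSet → Set
NonDegenerated dom v F G = ¬ Degenerated dom v F G

-- Let e be the value of v occurring in k ≥ 1 clauses; every other value a of v occurs in
-- exactly one clause D_a. A resolution on v therefore uses all the D_a and one clause C
-- containing (v , e), so up to set equality DP_v(F) consists of the v-free clauses of F
-- and the resolvents R(C) = (C ∖ v) ∪ ⋃ₐ (D_a ∖ v), and c(F) - Σ + ∏ is exactly the number
-- of these. Satisfying assignments pass between F and DP_v(F) by resetting v: to e, or to
-- the value of a side clause D_a that is already satisfied without v.
--
-- If F is minimally unsatisfiable, take an assignment falsifying exactly one clause P.
-- If some D_a whose value a differs from the value of v in P were satisfied without v,
-- moving v to a would satisfy F. This excludes clashes in R(C) and shows that the R(C) are pairwise distinct and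
-- differ from the v-free clauses, so DP_v(F) attains the bound and is again minimally
-- unsatisfiable. Conversely, if the bound is attained, the clauses of DP_v(F) correspond
-- bijectively to the v-free clauses and the clauses containing (v , e); removing a clause
-- of F then amounts to removing one of DP_v(F), whose satisfying assignment extends to v.

module Submission where

open import Defs

open import Data.Bool using (true; false)
open import Data.Empty using (⊥-elim)
open import Data.Fin using (Fin; zero; suc; punchOut; toℕ; fromℕ<; splitAt; _↑ˡ_; _↑ʳ_)
open import Data.Fin.Properties
  using (any?; punchOut-injective; injective⇒≤; toℕ-fromℕ<; toℕ<n; toℕ-injective;
         splitAt-↑ˡ; splitAt-↑ʳ; splitAt⁻¹-↑ˡ; splitAt⁻¹-↑ʳ; ↑ˡ-injective; ↑ʳ-injective)
  renaming (_≟_ to _≟F_)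
open import Data.List using ([]; _∷_; _++_; foldr; map; filter; concatMap; length; lookup; upTo)
open import Data.List.Membership.DecPropositional _≟L_ using (_∈?_)
open import Data.List.Membership.Propositional using (_∈_; _∉_; find; lose)
open import Data.List.Membership.Propositional.Properties
  using (∈-filter⁺; ∈-filter⁻; ∈-upTo⁺; ∈-upTo⁻; ∈-++⁺ˡ; ∈-++⁺ʳ; ∈-++⁻; ∈-concatMap⁺; ∈-concatMap⁻; ∈-lookup)
open import Data.List.Properties using (≡-dec; map-cong)
open import Data.List.Relation.Unary.All as All using (All; []; _∷_)
open import Data.List.Relation.Unary.AllPairs using (AllPairs; _∷_)
import Data.List.Relation.Unary.AllPairs.Properties as AP
open import Data.List.Relation.Unary.Any as Any using (Any; here; there)
open import Data.List.Relation.Unary.Any.Properties using (lookup-index)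
open import Data.List.Relation.Unary.Unique.Propositional using (Unique)
open import Data.List.Relation.Unary.Unique.Propositional.Properties using (upTo⁺)
open import Data.Nat using (ℕ; suc; _+_; _*_; _<_; _≤_; _≟_)
open import Data.Nat.ListAction using (sum)
open import Data.Nat.Properties
  using (<-irrefl; ≤-refl; ≤-trans; +-cancelʳ-≤; +-monoˡ-≤; ≮⇒≥; ≤⇒≯; 0≢1+n; +-suc;
         +-identityˡ; +-identityʳ; *-identityˡ; *-identityʳ; +-commutativeSemigroup)
open import Algebra.Properties.CommutativeSemigroup +-commutativeSemigroup
  using () renaming (interchange to +-interchange; xy∙z≈xz∙y to +-xy∙z≈xz∙y)
open import Data.Product using (∃-syntax; _×_; _,_; proj₁; proj₂)
open import Data.Sum using (_⊎_; inj₁; inj₂; [_,_]′)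
open import Data.Unit using (⊤; tt)
open import Function using (_∘_; id)
open import Function.Bundles using (_⇔_; Equivalence; mk⇔)
open import Function.Definitions using (Injective)
open import Relation.Binary.Definitions using (DecidableEquality)
open import Relation.Binary.PropositionalEquality
open import Relation.Nullary using (¬_; ¬?; yes; no; does)
open import Relation.Nullary.Decidable using (_×-dec_)
open import Relation.Unary using (Decidable)

injective⇒surjective : ∀ {m n} (f : Fin m → Fin n) → Injective _≡_ _≡_ f →
  n ≤ m → ∀ j → ∃[ i ] f i ≡ j
injective⇒surjective {m} {suc n} f f-inj n≤m j with any? (λ i → f i ≟F j)
... | yes hit = hit
... | no miss = ⊥-elim (<-irrefl refl (≤-trans n≤m (injective⇒≤ g-inj)))
  where
  j≢f : ∀ i → j ≢ f i
  j≢f i eq = miss (i , sym eq)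
  g : Fin m → Fin n
  g i = punchOut (j≢f i)
  g-inj : Injective _≡_ _≡_ g
  g-inj eq = f-inj (punchOut-injective (j≢f _) (j≢f _) eq)

module _ {A : Set} (_∙_ : ℕ → ℕ → ℕ) (ε : ℕ)
         (identityˡ : ∀ x → ε ∙ x ≡ x) (identityʳ : ∀ x → x ∙ ε ≡ x) (f : A → ℕ) where

  foldr-map-identity : ∀ xs → (∀ {a} → a ∈ xs → f a ≡ ε) → foldr _∙_ ε (map f xs) ≡ ε
  foldr-map-identity []       _  = refl
  foldr-map-identity (x ∷ xs) fε = begin
    f x ∙ foldr _∙_ ε (map f xs) ≡⟨ cong₂ _∙_ (fε (here refl)) (foldr-map-identity xs (fε ∘ there)) ⟩
    ε ∙ ε                        ≡⟨ identityˡ ε ⟩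
    ε                            ∎
    where open ≡-Reasoning

  foldr-map-unique : ∀ {a₀ xs} → Unique xs → a₀ ∈ xs → (∀ {a} → a ∈ xs → a ≢ a₀ → f a ≡ ε) →
    foldr _∙_ ε (map f xs) ≡ f a₀
  foldr-map-unique {xs = x ∷ xs} (x∉xs ∷ _) (here refl) fε = begin
    f x ∙ foldr _∙_ ε (map f xs) ≡⟨ cong (f x ∙_) (foldr-map-identity xs λ a∈xs →
                                      fε (there a∈xs) (All.lookup x∉xs a∈xs ∘ sym)) ⟩
    f x ∙ ε                      ≡⟨ identityʳ (f x) ⟩
    f x                          ∎
    where open ≡-Reasoning
  foldr-map-unique {xs = x ∷ xs} (x∉xs ∷ xs-unique) (there a₀∈xs) fε = begin
    f x ∙ foldr _∙_ ε (map f xs) ≡⟨ cong₂ _∙_ (fε (here refl) (All.lookup x∉xs a₀∈xs))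
                                              (foldr-map-unique xs-unique a₀∈xs (fε ∘ there)) ⟩
    ε ∙ f _                      ≡⟨ identityˡ _ ⟩
    f _                          ∎
    where open ≡-Reasoning

sum-map-+ : ∀ {A : Set} (f g : A → ℕ) xs → sum (map (λ a → f a + g a) xs) ≡ sum (map f xs) + sum (map g xs)
sum-map-+ f g []       = refl
sum-map-+ f g (x ∷ xs) =
  trans (cong ((f x + g x) +_) (sum-map-+ f g xs)) (+-interchange (f x) (g x) _ _)

length-filter-∷ : ∀ {A : Set} {P : A → Set} (P? : Decidable P) C Cs →
  length (filter P? (C ∷ Cs)) ≡ length (filter P? (C ∷ [])) + length (filter P? Cs)
length-filter-∷ P? C Cs with does (P? C)
... | true  = refl
... | false = refl

length≡filter+filter : ∀ {A : Set} {P : A → Set} (P? : Decidable P) Cs →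
  length Cs ≡ length (filter (¬? ∘ P?) Cs) + length (filter P? Cs)
length≡filter+filter P? []       = refl
length≡filter+filter P? (C ∷ Cs) with P? C
... | yes _ = trans (cong suc (length≡filter+filter P? Cs)) (sym (+-suc _ _))
... | no  _ = cong suc (length≡filter+filter P? Cs)

_≟C_ : DecidableEquality Clause
_≟C_ = ≡-dec _≟L_

≋-refl : ∀ {C} → C ≋ C
≋-refl _ = mk⇔ id id

≋-sym : ∀ {C D} → C ≋ D → D ≋ C
≋-sym C≋D x = mk⇔ (Equivalence.from (C≋D x)) (Equivalence.to (C≋D x))

≋-trans : ∀ {C D E} → C ≋ D → D ≋ E → C ≋ E
≋-trans C≋D D≋E x = mk⇔ (Equivalence.to (D≋E x) ∘ Equivalence.to (C≋D x))
                        (Equivalence.from (C≋D x) ∘ Equivalence.from (D≋E x))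

≋-respʳ-≡ : ∀ {C D E} → C ≋ D → D ≡ E → C ≋ E
≋-respʳ-≡ C≋D refl = C≋D

satClause-≋ : ∀ {dom} {φ : Assignment dom} {C D} → C ≋ D → SatClause φ C → SatClause φ D
satClause-≋ C≋D sat with x , x∈C , sx ← find sat = lose (Equivalence.to (C≋D x) x∈C) sx

lookup-≋-injective : ∀ {Cs} → AllPairs (λ C D → ¬ C ≋ D) Cs → ∀ i j → lookup Cs i ≋ lookup Cs j → i ≡ j
lookup-≋-injective (_   ∷ _)   zero    zero    _   = refl
lookup-≋-injective (C≉ ∷ _)   zero    (suc j) C≋D = ⊥-elim (All.lookup C≉ (∈-lookup j) C≋D)
lookup-≋-injective (C≉ ∷ _)   (suc i) zero    C≋D = ⊥-elim (All.lookup C≉ (∈-lookup i) (≋-sym C≋D))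
lookup-≋-injective (_   ∷ Cs≉) (suc i) (suc j) C≋D = cong suc (lookup-≋-injective Cs≉ i j C≋D)

∈⇒lookup : ∀ {A : Set} {x : A} {xs} → x ∈ xs → ∃[ i ] (x ≡ lookup xs i)
∈⇒lookup x∈xs = Any.index x∈xs , lookup-index x∈xs

SatisfiedExcept : ∀ {dom} → Assignment dom → ClauseSet → Clause → Set
SatisfiedExcept φ F P = ∀ {C} → C ∈ F → C ≢ P → SatClause φ C

module _ {dom : Domains} {F : ClauseSet} where

  MU⇒satisfiedExcept : MU dom F → ∀ {P} → P ∈ F →
    ∃[ φ ] (SatisfiedExcept φ F P × ¬ SatClause φ P)
  MU⇒satisfiedExcept (unsat , minimal) {P} P∈F = φ , satExcept , P-false
    where
    ≢P? : Decidable (_≢ P)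
    ≢P? C = ¬? (C ≟C P)
    sat : Satisfiable dom (filter ≢P? F)
    sat = minimal (filter ≢P? F) (λ _ → proj₁ ∘ ∈-filter⁻ ≢P?)
                  (P , P∈F , λ P∈ → proj₂ (∈-filter⁻ ≢P? {xs = F} P∈) refl)
    φ : Assignment dom
    φ = proj₁ sat
    satExcept : SatisfiedExcept φ F P
    satExcept C∈F C≢P = All.lookup (proj₂ sat) (∈-filter⁺ ≢P? C∈F C≢P)
    P-false : ¬ SatClause φ P
    P-false satP = unsat (φ , All.tabulate satAll)
      where
      satAll : ∀ {C} → C ∈ F → SatClause φ C
      satAll {C} C∈F with C ≟C P
      ... | yes refl = satP
      ... | no C≢P = satExcept C∈F C≢P

  satisfiedExcept⇒MU : ¬ Satisfiable dom F →
    (∀ {P} → P ∈ F → ∃[ φ ] SatisfiedExcept φ F P) → MU dom F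
  satisfiedExcept⇒MU unsat removable = unsat , minimal
    where
    minimal : ∀ H → (∀ C → C ∈ H → C ∈ F) → ∃[ P ] (P ∈ F × P ∉ H) → Satisfiable dom H
    minimal H H⊆F (P , P∈F , P∉H) with φ , satExcept ← removable P∈F =
      φ , All.tabulate (λ C∈H → satExcept (H⊆F _ C∈H) (λ { refl → P∉H C∈H }))

module _ {F : ClauseSet} {x : Lit} (occ≡1 : occ x F ≡ 1) where

  occ≡1⇒unique : ∀ {P Q} → P ∈ F → Q ∈ F → x ∈ P → x ∈ Q → P ≡ Q
  occ≡1⇒unique P∈F Q∈F x∈P x∈Q = singleton occ≡1 (∈-filter⁺ (x ∈?_) P∈F x∈P) (∈-filter⁺ (x ∈?_) Q∈F x∈Q)
    where
    singleton : ∀ {Cs : ClauseSet} {P Q} → length Cs ≡ 1 → P ∈ Cs → Q ∈ Cs → P ≡ Q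
    singleton {_ ∷ []} _ (here refl) (here refl) = refl

  occ≡1⇒∃ : ∃[ D ] (D ∈ F × x ∈ D)
  occ≡1⇒∃ with filter (x ∈?_) F in eq
  ... | []    = ⊥-elim (0≢1+n occ≡1)
  ... | D ∷ _ = D , ∈-filter⁻ (x ∈?_) (subst (D ∈_) (sym eq) (here refl))

Occurs? : ∀ v → Decidable (Occurs v)
Occurs? v = Any.any? (λ x → var x ≟ v)

module _ {dom : Domains} (v : Var) where

  occSum-[_] : ∀ {C} → IsClause dom C → occSum dom v (C ∷ []) ≡ length (filter (Occurs? v) (C ∷ []))
  occSum-[_] {C} C-wf with Occurs? v C
  ... | no v∉C = foldr-map-identity _+_ 0 +-identityˡ +-identityʳ _ (upTo (dom v)) (λ _ → absent _)
    where
    absent : ∀ a → occ (v , a) (C ∷ []) ≡ 0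
    absent a with (v , a) ∈? C
    ... | yes va∈C = ⊥-elim (v∉C (lose va∈C refl))
    ... | no  _    = refl
  ... | yes v∈C with (v , a₀) , va₀∈C , refl ← find v∈C =
    trans (foldr-map-unique _+_ 0 +-identityˡ +-identityʳ _ (upTo⁺ (dom v)) (∈-upTo⁺ (proj₁ C-wf _ va₀∈C))
                            (λ _ a≢a₀ → absent _ a≢a₀))
          present
    where
    absent : ∀ a → a ≢ a₀ → occ (v , a) (C ∷ []) ≡ 0
    absent a a≢a₀ with (v , a) ∈? C
    ... | yes va∈C = ⊥-elim (a≢a₀ (cong proj₂ (proj₂ C-wf _ _ va∈C va₀∈C refl)))
    ... | no  _    = refl
    present : occ (v , a₀) (C ∷ []) ≡ 1
    present with (v , a₀) ∈? C
    ... | yes _      = refl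
    ... | no va₀∉C = ⊥-elim (va₀∉C va₀∈C)

  occSum≡count : ∀ {F} → All (IsClause dom) F → occSum dom v F ≡ length (filter (Occurs? v) F)
  occSum≡count {[]}    []            = foldr-map-identity _+_ 0 +-identityˡ +-identityʳ _ (upTo (dom v)) (λ _ → refl)
  occSum≡count {C ∷ F} (C-wf ∷ F-wf) = begin
    sum (map (λ a → occ (v , a) (C ∷ F)) (upTo (dom v)))
      ≡⟨ cong sum (map-cong (λ a → length-filter-∷ ((v , a) ∈?_) C F) (upTo (dom v))) ⟩
    sum (map (λ a → occ (v , a) (C ∷ []) + occ (v , a) F) (upTo (dom v)))
      ≡⟨ sum-map-+ (λ a → occ (v , a) (C ∷ [])) (λ a → occ (v , a) F) (upTo (dom v)) ⟩
    occSum dom v (C ∷ []) + occSum dom v F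
      ≡⟨ cong₂ _+_ occSum-[ C-wf ] (occSum≡count F-wf) ⟩
    length (filter (Occurs? v) (C ∷ [])) + length (filter (Occurs? v) F)
      ≡⟨ length-filter-∷ (Occurs? v) C F ⟨
    length (filter (Occurs? v) (C ∷ F)) ∎
    where open ≡-Reasoning

falsified-value : ∀ {dom} {φ : Assignment dom} {C x} → ¬ SatClause φ C → x ∈ C → toℕ (φ (var x)) ≡ proj₂ x
falsified-value {φ = φ} {x = x} C-false x∈C with toℕ (φ (var x)) ≟ proj₂ x
... | yes φx≡ = φx≡
... | no  φx≢ = ⊥-elim (C-false (lose x∈C φx≢))

module Assignments {dom : Domains} (v : Var) where

  update : Assignment dom → ∀ {b} → b < dom v → Assignment dom
  update φ b<n w with w ≟ v
  ... | yes refl = fromℕ< b<n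
  ... | no  _    = φ w

  update-v : ∀ φ {b} (b<n : b < dom v) → toℕ (update φ b<n v) ≡ b
  update-v φ b<n with v ≟ v
  ... | yes refl = toℕ-fromℕ< b<n
  ... | no  v≢v  = ⊥-elim (v≢v refl)

  update-other : ∀ φ {b} (b<n : b < dom v) {w} → w ≢ v → update φ b<n w ≡ φ w
  update-other φ b<n {w} w≢v with w ≟ v
  ... | yes refl = ⊥-elim (w≢v refl)
  ... | no  _    = refl

  SatOff : Assignment dom → Clause → Set
  SatOff φ = Any (λ x → var x ≢ v × SatLit φ x)

  SatOff? : ∀ φ → Decidable (SatOff φ)
  SatOff? φ = Any.any? (λ x → ¬? (var x ≟ v) ×-dec ¬? (toℕ (φ (var x)) ≟ proj₂ x))

  satOff⇒sat-update : ∀ {φ C b} (b<n : b < dom v) → SatOff φ C → SatClause (update φ b<n) C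
  satOff⇒sat-update {φ} b<n satOff with x , x∈C , x≢v , sx ← find satOff =
    lose x∈C (sx ∘ trans (cong toℕ (sym (update-other φ b<n x≢v))))

  sat-update-by-v : ∀ {φ C b c} (b<n : b < dom v) → (v , c) ∈ C → c ≢ b → SatClause (update φ b<n) C
  sat-update-by-v {φ} b<n vc∈C c≢b = lose vc∈C (λ φv≡c → c≢b (trans (sym φv≡c) (update-v φ b<n)))

  sat⇒satOff⊎v : ∀ {φ C} → SatClause φ C → SatOff φ C ⊎ ∃[ c ] ((v , c) ∈ C × toℕ (φ v) ≢ c)
  sat⇒satOff⊎v sat with (w , c) , x∈C , sx ← find sat | w ≟ v
  ... | yes refl = inj₂ (c , x∈C , sx)
  ... | no  w≢v  = inj₁ (lose x∈C (w≢v , sx))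

  sat-vFree⇒satOff : ∀ {φ C} → ¬ Occurs v C → SatClause φ C → SatOff φ C
  sat-vFree⇒satOff v∉C sat with sat⇒satOff⊎v sat
  ... | inj₁ satOff          = satOff
  ... | inj₂ (_ , vc∈C , _) = ⊥-elim (v∉C (lose vc∈C refl))

  update-sat : ∀ {φ C b} (b<n : b < dom v) → (¬ Occurs v C → SatClause φ C) → ((v , b) ∈ C → SatOff φ C) →
    SatClause (update φ b<n) C
  update-sat {φ} {C} {b} b<n vFree-sat vb-satOff with Occurs? v C
  ... | no  v∉C = satOff⇒sat-update b<n (sat-vFree⇒satOff v∉C (vFree-sat v∉C))
  ... | yes v∈C with (_ , c) , vc∈C , refl ← find v∈C | c ≟ b
  ...   | yes refl = satOff⇒sat-update b<n (vb-satOff vc∈C)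
  ...   | no  c≢b  = sat-update-by-v b<n vc∈C c≢b

module SingularVariable {dom : Domains} {F : ClauseSet} (F-wf : IsClauseSet dom F)
  (v : Var) {e : ℕ} (e<n : e < dom v)
  (side-occ≡1 : ∀ a → a < dom v → a ≢ e → occ (v , a) F ≡ 1) where

  open Assignments {dom} v

  clause-wf : ∀ {C} → C ∈ F → IsClause dom C
  clause-wf = All.lookup (proj₁ F-wf)

  value<dom : ∀ {C x} → C ∈ F → x ∈ C → proj₂ x < dom (var x)
  value<dom C∈F = proj₁ (clause-wf C∈F) _

  lit-unique : ∀ {C x y} → C ∈ F → x ∈ C → y ∈ C → var x ≡ var y → x ≡ y
  lit-unique C∈F = proj₂ (clause-wf C∈F) _ _

  v-value-unique : ∀ {C a b} → C ∈ F → (v , a) ∈ C → (v , b) ∈ C → a ≡ b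
  v-value-unique C∈F va∈C vb∈C = cong proj₂ (lit-unique C∈F va∈C vb∈C refl)

  v-value : ∀ {C} → Occurs v C → ∃[ a ] ((v , a) ∈ C)
  v-value v∈C with (_ , a) , va∈C , refl ← find v∈C = a , va∈C

  side-unique : ∀ {a P Q} → a ≢ e → P ∈ F → Q ∈ F → (v , a) ∈ P → (v , a) ∈ Q → P ≡ Q
  side-unique a≢e P∈F Q∈F va∈P = occ≡1⇒unique (side-occ≡1 _ (value<dom P∈F va∈P) a≢e) P∈F Q∈F va∈P

  side-exists : ∀ {a} → a < dom v → a ≢ e → ∃[ D ] (D ∈ F × (v , a) ∈ D)
  side-exists a<n a≢e = occ≡1⇒∃ (side-occ≡1 _ a<n a≢e)

  IsSide : Clause → Set
  IsSide C = Occurs v C × (v , e) ∉ C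

  isSide? : Decidable IsSide
  isSide? C = Occurs? v C ×-dec ¬? ((v , e) ∈? C)

  Sides : ClauseSet
  Sides = filter isSide? F

  side⁺ : ∀ {D b} → D ∈ F → (v , b) ∈ D → b ≢ e → D ∈ Sides
  side⁺ D∈F vb∈D b≢e = ∈-filter⁺ isSide? D∈F (lose vb∈D refl , b≢e ∘ v-value-unique D∈F vb∈D)

  side⁻ : ∀ {D} → D ∈ Sides → D ∈ F × ∃[ b ] ((v , b) ∈ D × b ≢ e)
  side⁻ D∈Sides with D∈F , v∈D , ve∉D ← ∈-filter⁻ isSide? D∈Sides | v-value v∈D
  ... | b , vb∈D = D∈F , b , vb∈D , λ { refl → ve∉D vb∈D }

  offV? : Decidable (λ x → var x ≢ v)
  offV? x = ¬? (var x ≟ v)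

  withoutV : Clause → Clause
  withoutV = filter offV?

  resolventOf : Clause → Clause
  resolventOf C = withoutV C ++ concatMap withoutV Sides

  ∈-resolventOf⁺ˡ : ∀ {C x} → x ∈ C → var x ≢ v → x ∈ resolventOf C
  ∈-resolventOf⁺ˡ x∈C x≢v = ∈-++⁺ˡ (∈-filter⁺ offV? x∈C x≢v)

  ∈-resolventOf⁺ʳ : ∀ C {D x} → D ∈ Sides → x ∈ D → var x ≢ v → x ∈ resolventOf C
  ∈-resolventOf⁺ʳ C D∈Sides x∈D x≢v =
    ∈-++⁺ʳ (withoutV C) (∈-concatMap⁺ withoutV (lose D∈Sides (∈-filter⁺ offV? x∈D x≢v)))

  ∈-resolventOf⁻ : ∀ C {x} → x ∈ resolventOf C →
    var x ≢ v × (x ∈ C ⊎ ∃[ D ] (D ∈ Sides × x ∈ D))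
  ∈-resolventOf⁻ C x∈R with ∈-++⁻ (withoutV C) x∈R
  ... | inj₁ x∈C′ = let x∈C , x≢v = ∈-filter⁻ offV? x∈C′ in x≢v , inj₁ x∈C
  ... | inj₂ x∈Ds with D , D∈Sides , x∈D′ ← find (∈-concatMap⁻ withoutV {xs = Sides} x∈Ds) =
    let x∈D , x≢v = ∈-filter⁻ offV? x∈D′ in x≢v , inj₂ (D , D∈Sides , x∈D)

  resolvent-shape : ∀ {R} → IsResolvent dom v F R → ∃[ C ] (C ∈ F × (v , e) ∈ C × R ≋ resolventOf C)
  resolvent-shape {R} (Cs , Cs∈F , cover , R≋⋃ , _) = Cs i* , Cs∈F i* , ve∈C* , R≋resolvent
    where
    cover-index : Fin (dom v) → Fin (dom v)
    cover-index a = proj₁ (cover (toℕ a) (toℕ<n a))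
    covered : ∀ a → (v , toℕ a) ∈ Cs (cover-index a)
    covered a = proj₂ (cover (toℕ a) (toℕ<n a))
    cover-index-injective : Injective _≡_ _≡_ cover-index
    cover-index-injective {a} {b} eq = toℕ-injective
      (v-value-unique (Cs∈F _) (covered a) (subst (λ i → (v , toℕ b) ∈ Cs i) (sym eq) (covered b)))
    cover-index-surjective : ∀ i → ∃[ a ] cover-index a ≡ i
    cover-index-surjective = injective⇒surjective cover-index cover-index-injective ≤-refl
    i* : Fin (dom v)
    i* = cover-index (fromℕ< e<n)
    ve∈C* : (v , e) ∈ Cs i*
    ve∈C* = subst (λ a → (v , a) ∈ Cs i*) (toℕ-fromℕ< e<n) (covered (fromℕ< e<n))
    main-or-side : ∀ i → i ≡ i* ⊎ Cs i ∈ Sides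
    main-or-side i with a , refl ← cover-index-surjective i | toℕ a ≟ e
    ... | yes a≡e = inj₁ (cong cover-index (toℕ-injective (trans a≡e (sym (toℕ-fromℕ< e<n)))))
    ... | no  a≢e = inj₂ (side⁺ (Cs∈F _) (covered a) a≢e)
    R≋resolvent : R ≋ resolventOf (Cs i*)
    R≋resolvent x = mk⇔ to from
      where
      to : x ∈ R → x ∈ resolventOf (Cs i*)
      to x∈R with i , x∈Cᵢ , x≢v ← Equivalence.to (R≋⋃ x) x∈R | main-or-side i
      ... | inj₁ refl    = ∈-resolventOf⁺ˡ x∈Cᵢ x≢v
      ... | inj₂ Cᵢ-side = ∈-resolventOf⁺ʳ (Cs i*) Cᵢ-side x∈Cᵢ x≢v
      from : x ∈ resolventOf (Cs i*) → x ∈ R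
      from x∈res with ∈-resolventOf⁻ (Cs i*) x∈res
      ... | x≢v , inj₁ x∈C* = Equivalence.from (R≋⋃ x) (i* , x∈C* , x≢v)
      ... | x≢v , inj₂ (D , D∈Sides , x∈D)
        with D∈F , b , vb∈D , b≢e ← side⁻ D∈Sides
        with i , vb∈Cᵢ ← cover b (value<dom D∈F vb∈D) =
        Equivalence.from (R≋⋃ x) (i , subst (x ∈_) (side-unique b≢e D∈F (Cs∈F i) vb∈D vb∈Cᵢ) x∈D , x≢v)

  resolventOf-isResolvent : ∀ {C} → C ∈ F → (v , e) ∈ C → IsClause dom (resolventOf C) →
    IsResolvent dom v F (resolventOf C)
  resolventOf-isResolvent {C} C∈F ve∈C R-clause = Cs , Cs∈F , cover , R≋⋃ , R-clause
    where
    pick : ∀ a → a < dom v → ∃[ P ] (P ∈ F × (v , a) ∈ P × (P ≡ C ⊎ P ∈ Sides))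
    pick a a<n with a ≟ e
    ... | yes refl = C , C∈F , ve∈C , inj₁ refl
    ... | no  a≢e  with D , D∈F , va∈D ← side-exists a<n a≢e = D , D∈F , va∈D , inj₂ (side⁺ D∈F va∈D a≢e)
    Cs : Fin (dom v) → Clause
    Cs i = proj₁ (pick (toℕ i) (toℕ<n i))
    Cs∈F : ∀ i → Cs i ∈ F
    Cs∈F i = proj₁ (proj₂ (pick (toℕ i) (toℕ<n i)))
    main-or-side : ∀ i → Cs i ≡ C ⊎ Cs i ∈ Sides
    main-or-side i = proj₂ (proj₂ (proj₂ (pick (toℕ i) (toℕ<n i))))
    cover : ∀ a → a < dom v → ∃[ i ] ((v , a) ∈ Cs i)
    cover a a<n = fromℕ< a<n , subst (λ b → (v , b) ∈ Cs (fromℕ< a<n)) (toℕ-fromℕ< a<n)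
                                     (proj₁ (proj₂ (proj₂ (pick _ (toℕ<n (fromℕ< a<n))))))
    main : ∀ i → (v , e) ∈ Cs i → Cs i ≡ C
    main i ve∈Cᵢ with main-or-side i
    ... | inj₁ Cᵢ≡C   = Cᵢ≡C
    ... | inj₂ Cᵢ-side with Cᵢ∈F , b , vb∈Cᵢ , b≢e ← side⁻ Cᵢ-side =
      ⊥-elim (b≢e (v-value-unique Cᵢ∈F vb∈Cᵢ ve∈Cᵢ))
    R≋⋃ : ∀ x → (x ∈ resolventOf C) ⇔ (∃[ i ] (x ∈ Cs i × var x ≢ v))
    R≋⋃ x = mk⇔ to from
      where
      to : x ∈ resolventOf C → ∃[ i ] (x ∈ Cs i × var x ≢ v)
      to x∈R with ∈-resolventOf⁻ C x∈R
      ... | x≢v , inj₁ x∈C with i , ve∈Cᵢ ← cover e e<n = i , subst (x ∈_) (sym (main i ve∈Cᵢ)) x∈C , x≢v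
      ... | x≢v , inj₂ (D , D∈Sides , x∈D)
        with D∈F , b , vb∈D , b≢e ← side⁻ D∈Sides
        with i , vb∈Cᵢ ← cover b (value<dom D∈F vb∈D) =
        i , subst (x ∈_) (side-unique b≢e D∈F (Cs∈F i) vb∈D vb∈Cᵢ) x∈D , x≢v
      from : ∃[ i ] (x ∈ Cs i × var x ≢ v) → x ∈ resolventOf C
      from (i , x∈Cᵢ , x≢v) with main-or-side i
      ... | inj₁ Cᵢ≡C   = ∈-resolventOf⁺ˡ (subst (x ∈_) Cᵢ≡C x∈Cᵢ) x≢v
      ... | inj₂ Cᵢ-side = ∈-resolventOf⁺ʳ C Cᵢ-side x∈Cᵢ x≢v

  sat⇒sat-resolventOf : ∀ {φ C} → (∀ {P} → P ∈ F → Occurs v P → SatClause φ P) →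
    C ∈ F → (v , e) ∈ C → SatClause φ (resolventOf C)
  sat⇒sat-resolventOf {φ} {C} sat-v C∈F ve∈C with sat⇒satOff⊎v (sat-v C∈F (lose ve∈C refl))
  ... | inj₁ satOff with x , x∈C , x≢v , sx ← find satOff = lose (∈-resolventOf⁺ˡ x∈C x≢v) sx
  ... | inj₂ (c , vc∈C , φv≢c) = via-side (λ φv≡e → φv≢c (trans φv≡e (v-value-unique C∈F ve∈C vc∈C)))
    where
    via-side : toℕ (φ v) ≢ e → SatClause φ (resolventOf C)
    via-side φv≢e with D , D∈F , va∈D ← side-exists (toℕ<n (φ v)) φv≢e
                  with sat⇒satOff⊎v (sat-v D∈F (lose va∈D refl))
    ... | inj₂ (c′ , vc′∈D , φv≢c′) = ⊥-elim (φv≢c′ (v-value-unique D∈F va∈D vc′∈D))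
    ... | inj₁ satOff with x , x∈D , x≢v , sx ← find satOff =
      lose (∈-resolventOf⁺ʳ C (side⁺ D∈F va∈D φv≢e) x∈D x≢v) sx

  extend : ∀ {ψ} (S : Clause → Set) →
    (∀ {C} → C ∈ F → S C → ¬ Occurs v C → SatClause ψ C) →
    (∀ {C} → C ∈ F → S C → (v , e) ∈ C → SatClause ψ (resolventOf C)) →
    ∃[ φ ] (∀ {C} → C ∈ F → S C → SatClause φ C)
  extend {ψ} S vFree-sat resolvent-sat with Any.any? (SatOff? ψ) Sides
  ... | yes some-side
    with D , D∈Sides , D-satOff ← find some-side
    with D∈F , b , vb∈D , b≢e ← side⁻ D∈Sides =
    update ψ (value<dom D∈F vb∈D) , λ C∈F SC → update-sat _ (vFree-sat C∈F SC)
      (λ vb∈C → subst (SatOff ψ) (side-unique b≢e D∈F C∈F vb∈D vb∈C) D-satOff)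
  ... | no no-side = update ψ e<n , λ C∈F SC → update-sat e<n (vFree-sat C∈F SC) (satOff-main C∈F SC)
    where
    satOff-main : ∀ {C} → C ∈ F → S C → (v , e) ∈ C → SatOff ψ C
    satOff-main {C} C∈F SC ve∈C with x , x∈R , sx ← find (resolvent-sat C∈F SC ve∈C) | ∈-resolventOf⁻ C x∈R
    ... | x≢v , inj₁ x∈C                 = lose x∈C (x≢v , sx)
    ... | x≢v , inj₂ (D , D∈Sides , x∈D) = ⊥-elim (no-side (lose D∈Sides (lose x∈D (x≢v , sx))))

  satisfiedExcept-side : ∀ {ψ P a} → (∀ {C} → C ∈ F → ¬ Occurs v C → SatClause ψ C) →
    P ∈ F → (v , a) ∈ P → a ≢ e → ∃[ φ ] SatisfiedExcept φ F P
  satisfiedExcept-side {ψ} vFree-sat P∈F va∈P a≢e =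
    update ψ (value<dom P∈F va∈P) , λ C∈F C≢P → update-sat _ (vFree-sat C∈F)
      (λ va∈C → ⊥-elim (C≢P (side-unique a≢e C∈F P∈F va∈C va∈P)))

  -- Q is the only clause containing (v , b), so moving v to b falsifies no other clause.
  switch-to-side : ∀ {φ P Q a b} → SatisfiedExcept φ F P → P ∈ F → (v , a) ∈ P →
    Q ∈ F → (v , b) ∈ Q → b ≢ e → b ≢ a → SatOff φ Q → Satisfiable dom F
  switch-to-side {φ} {P} {b = b} satExcept P∈F va∈P Q∈F vb∈Q b≢e b≢a Q-satOff =
    update φ b<n , All.tabulate sat
    where
    b<n : b < dom v
    b<n = value<dom Q∈F vb∈Q
    sat : ∀ {C} → C ∈ F → SatClause (update φ b<n) C
    sat {C} C∈F with C ≟C P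
    ... | yes refl = sat-update-by-v b<n va∈P (b≢a ∘ sym)
    ... | no  C≢P  = update-sat b<n (λ _ → satExcept C∈F C≢P)
      (λ vb∈C → subst (SatOff φ) (side-unique b≢e Q∈F C∈F vb∈Q vb∈C) Q-satOff)

  -- φ falsifies C₀, so φ v = e and every other clause with (v , e) is satisfied off v.
  sat-resolventOf-except-main : ∀ {φ C₀ C} → SatisfiedExcept φ F C₀ → ¬ SatClause φ C₀ → (v , e) ∈ C₀ →
    C ∈ F → (v , e) ∈ C → C ≢ C₀ → SatClause φ (resolventOf C)
  sat-resolventOf-except-main satExcept C₀-false ve∈C₀ C∈F ve∈C C≢C₀ with sat⇒satOff⊎v (satExcept C∈F C≢C₀)
  ... | inj₁ satOff with x , x∈C , x≢v , sx ← find satOff = lose (∈-resolventOf⁺ˡ x∈C x≢v) sx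
  ... | inj₂ (c , vc∈C , φv≢c) =
    ⊥-elim (φv≢c (trans (falsified-value C₀-false ve∈C₀) (v-value-unique C∈F ve∈C vc∈C)))

  module _ (mu : MU dom F) where

    no-clash : ∀ {P Q a b x y} → P ∈ F → (v , a) ∈ P → Q ∈ F → (v , b) ∈ Q → b ≢ e → b ≢ a →
      x ∈ P → y ∈ Q → var x ≡ var y → var y ≢ v → x ≡ y
    no-clash {x = x₁ , x₂} {y = y₁ , y₂} P∈F va∈P Q∈F vb∈Q b≢e b≢a x∈P y∈Q refl y≢v with x₂ ≟ y₂
    ... | yes refl = refl
    ... | no  x₂≢y₂ with φ , satExcept , P-false ← MU⇒satisfiedExcept mu P∈F =
      ⊥-elim (proj₁ mu (switch-to-side satExcept P∈F va∈P Q∈F vb∈Q b≢e b≢a (lose y∈Q (y≢v , y-true))))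
      where
      y-true : toℕ (φ y₁) ≢ y₂
      y-true φy≡y₂ = x₂≢y₂ (trans (sym (falsified-value P-false x∈P)) φy≡y₂)

    resolventOf-false : ∀ {φ C} → SatisfiedExcept φ F C → ¬ SatClause φ C → C ∈ F → (v , e) ∈ C →
      ¬ SatClause φ (resolventOf C)
    resolventOf-false {φ} {C} satExcept C-false C∈F ve∈C sat
      with x , x∈R , sx ← find sat | ∈-resolventOf⁻ C x∈R
    ... | _   , inj₁ x∈C = C-false (lose x∈C sx)
    ... | x≢v , inj₂ (D , D∈Sides , x∈D) with D∈F , b , vb∈D , b≢e ← side⁻ D∈Sides =
      proj₁ mu (switch-to-side satExcept C∈F ve∈C D∈F vb∈D b≢e b≢e (lose x∈D (x≢v , sx)))

    resolventOf-isClause : ∀ {C} → C ∈ F → (v , e) ∈ C → IsClause dom (resolventOf C)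
    resolventOf-isClause {C} C∈F ve∈C = in-domain , var-unique
      where
      in-domain : ∀ x → x ∈ resolventOf C → proj₂ x < dom (var x)
      in-domain x x∈R with ∈-resolventOf⁻ C x∈R
      ... | _ , inj₁ x∈C                 = value<dom C∈F x∈C
      ... | _ , inj₂ (D , D∈Sides , x∈D) = value<dom (proj₁ (side⁻ D∈Sides)) x∈D
      var-unique : ∀ x y → x ∈ resolventOf C → y ∈ resolventOf C → var x ≡ var y → x ≡ y
      var-unique x y x∈R y∈R x~y with ∈-resolventOf⁻ C x∈R | ∈-resolventOf⁻ C y∈R
      ... | _ , inj₁ x∈C | _ , inj₁ y∈C = lit-unique C∈F x∈C y∈C x~y
      ... | _ , inj₁ x∈C | y≢v , inj₂ (D , D∈Sides , y∈D) with D∈F , b , vb∈D , b≢e ← side⁻ D∈Sides =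
        no-clash C∈F ve∈C D∈F vb∈D b≢e b≢e x∈C y∈D x~y y≢v
      ... | x≢v , inj₂ (D , D∈Sides , x∈D) | _ , inj₁ y∈C with D∈F , b , vb∈D , b≢e ← side⁻ D∈Sides =
        sym (no-clash C∈F ve∈C D∈F vb∈D b≢e b≢e y∈C x∈D (sym x~y) x≢v)
      ... | _ , inj₂ (D , D∈Sides , x∈D) | y≢v , inj₂ (D′ , D′∈Sides , y∈D′)
        with D∈F , b , vb∈D , b≢e ← side⁻ D∈Sides | D′∈F , b′ , vb′∈D′ , b′≢e ← side⁻ D′∈Sides | b′ ≟ b
      ... | yes refl = lit-unique D∈F x∈D (subst (_ ∈_) (side-unique b≢e D′∈F D∈F vb′∈D′ vb∈D) y∈D′) x~y
      ... | no  b′≢b = no-clash D∈F vb∈D D′∈F vb′∈D′ b′≢e b′≢b x∈D y∈D′ x~y y≢v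

    MU⇒resolventOf-isResolvent : ∀ {C} → C ∈ F → (v , e) ∈ C → IsResolvent dom v F (resolventOf C)
    MU⇒resolventOf-isResolvent C∈F ve∈C = resolventOf-isResolvent C∈F ve∈C (resolventOf-isClause C∈F ve∈C)

    resolventOf-≉-vFree : ∀ {C N} → C ∈ F → (v , e) ∈ C → N ∈ F → ¬ Occurs v N → ¬ (resolventOf C ≋ N)
    resolventOf-≉-vFree C∈F ve∈C N∈F v∉N R≋N
      with φ , satExcept , C-false ← MU⇒satisfiedExcept mu C∈F
      with x , x∈N , sx ← find (satExcept N∈F (λ { refl → v∉N (lose ve∈C refl) })) =
      resolventOf-false satExcept C-false C∈F ve∈C (lose (Equivalence.from (R≋N x) x∈N) sx)

    resolventOf-≋-injective : ∀ {C₁ C₂} → C₁ ∈ F → (v , e) ∈ C₁ → C₂ ∈ F → (v , e) ∈ C₂ →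
      resolventOf C₁ ≋ resolventOf C₂ → C₁ ≡ C₂
    resolventOf-≋-injective {C₁} {C₂} C₁∈F ve∈C₁ C₂∈F ve∈C₂ R₁≋R₂ with C₁ ≟C C₂
    ... | yes C₁≡C₂ = C₁≡C₂
    ... | no  C₁≢C₂ with φ , satExcept , C₁-false ← MU⇒satisfiedExcept mu C₁∈F =
      ⊥-elim (resolventOf-false satExcept C₁-false C₁∈F ve∈C₁ (satClause-≋ (≋-sym R₁≋R₂)
        (sat-resolventOf-except-main satExcept C₁-false ve∈C₁ C₂∈F ve∈C₂ (C₁≢C₂ ∘ sym))))

  VFree Mains : ClauseSet
  VFree = filter (¬? ∘ Occurs? v) F
  Mains = filter ((v , e) ∈?_) F

  occProd≡|Mains| : occProd dom v F ≡ length Mains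
  occProd≡|Mains| = foldr-map-unique _*_ 1 *-identityˡ *-identityʳ _ (upTo⁺ (dom v)) (∈-upTo⁺ e<n)
                      (λ a∈ a≢e → side-occ≡1 _ (∈-upTo⁻ a∈) a≢e)

  c+occProd≡ : c F + occProd dom v F ≡ (length VFree + length Mains) + occSum dom v F
  c+occProd≡ = begin
    c F + occProd dom v F
      ≡⟨ cong₂ _+_ (length≡filter+filter (Occurs? v) F) occProd≡|Mains| ⟩
    (length VFree + length (filter (Occurs? v) F)) + length Mains
      ≡⟨ +-xy∙z≈xz∙y (length VFree) _ _ ⟩
    (length VFree + length Mains) + length (filter (Occurs? v) F)
      ≡⟨ cong ((length VFree + length Mains) +_) (occSum≡count v (proj₁ F-wf)) ⟨
    (length VFree + length Mains) + occSum dom v F ∎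
    where open ≡-Reasoning

  nonDegenerated⇔ : 1 ≤ occ (v , e) F → ∀ G → NonDegenerated dom v F G ⇔ length VFree + length Mains ≤ c G
  nonDegenerated⇔ main-occ G = mk⇔ to from
    where
    to : NonDegenerated dom v F G → length VFree + length Mains ≤ c G
    to nonDeg = +-cancelʳ-≤ (occSum dom v F) _ _
      (subst (_≤ c G + occSum dom v F) c+occProd≡ (≮⇒≥ (nonDeg ∘ inj₂)))
    from : length VFree + length Mains ≤ c G → NonDegenerated dom v F G
    from _ (inj₁ (a , a<n , occ≡0)) with a ≟ e
    ... | yes refl = <-irrefl (sym occ≡0) main-occ
    ... | no  a≢e  = 0≢1+n (trans (sym occ≡0) (side-occ≡1 a a<n a≢e))
    from size≤ (inj₂ lt) = ≤⇒≯ (subst (_≤ c G + occSum dom v F) (sym c+occProd≡) (+-monoˡ-≤ _ size≤)) lt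

  module DP {G : ClauseSet} (G-dp : IsDP dom v F G) where

    nv k : ℕ
    nv = length VFree
    k  = length Mains

    dpClause : Fin (nv + k) → Clause
    dpClause q = [ lookup VFree , resolventOf ∘ lookup Mains ]′ (splitAt nv q)

    dpClause-vFree : ∀ j → dpClause (j ↑ˡ k) ≡ lookup VFree j
    dpClause-vFree j rewrite splitAt-↑ˡ nv j k = refl

    dpClause-main : ∀ j → dpClause (nv ↑ʳ j) ≡ resolventOf (lookup Mains j)
    dpClause-main j rewrite splitAt-↑ʳ nv k j = refl

    ↑ˡ≢↑ʳ : ∀ i j → i ↑ˡ k ≢ nv ↑ʳ j
    ↑ˡ≢↑ʳ i j eq with () ← trans (sym (splitAt-↑ˡ nv i k)) (trans (cong (splitAt nv) eq) (splitAt-↑ʳ nv k j))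

    split : ∀ q → ∃[ j ] (q ≡ j ↑ˡ k) ⊎ ∃[ j ] (q ≡ nv ↑ʳ j)
    split q with splitAt nv q in eq
    ... | inj₁ j = inj₁ (j , sym (splitAt⁻¹-↑ˡ eq))
    ... | inj₂ j = inj₂ (j , sym (splitAt⁻¹-↑ʳ eq))

    Position : Clause → Fin (nv + k) → Set
    Position C q = ∃[ j ] (q ≡ j ↑ˡ k × C ≡ lookup VFree j) ⊎ ∃[ j ] (q ≡ nv ↑ʳ j × C ≡ lookup Mains j)

    position-unique : ∀ {C D q} → Position C q → Position D q → C ≡ D
    position-unique (inj₁ (i , refl , refl)) (inj₁ (j , eq , refl)) = cong (lookup VFree) (↑ˡ-injective k i j eq)
    position-unique (inj₁ (i , refl , _))    (inj₂ (j , eq , _))    = ⊥-elim (↑ˡ≢↑ʳ i j eq)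
    position-unique (inj₂ (i , refl , _))    (inj₁ (j , eq , _))    = ⊥-elim (↑ˡ≢↑ʳ j i (sym eq))
    position-unique (inj₂ (i , refl , refl)) (inj₂ (j , eq , refl)) = cong (lookup Mains) (↑ʳ-injective nv i j eq)

    vFree-position : ∀ {C} → C ∈ F → ¬ Occurs v C → ∃[ q ] (Position C q × dpClause q ≡ C)
    vFree-position C∈F v∉C with j , refl ← ∈⇒lookup (∈-filter⁺ (¬? ∘ Occurs? v) C∈F v∉C) =
      j ↑ˡ k , inj₁ (j , refl , refl) , dpClause-vFree j

    main-position : ∀ {C} → C ∈ F → (v , e) ∈ C → ∃[ q ] (Position C q × dpClause q ≡ resolventOf C)
    main-position C∈F ve∈C with j , refl ← ∈⇒lookup (∈-filter⁺ ((v , e) ∈?_) C∈F ve∈C) =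
      nv ↑ʳ j , inj₂ (j , refl , refl) , dpClause-main j

    InDP : Clause → Set
    InDP C = ∃[ D ] (D ∈ F × ¬ Occurs v D × C ≋ D) ⊎ IsResolvent dom v F C

    G-member⁻ : ∀ {g} → g ∈ G → InDP g
    G-member⁻ {g} g∈G = Equivalence.to (proj₂ G-dp g) (lose g∈G ≋-refl)

    G-member⁺ : ∀ {g} → InDP g → ∃[ h ] (h ∈ G × g ≋ h)
    G-member⁺ {g} g∈DP = find (Equivalence.from (proj₂ G-dp g) g∈DP)

    G-≋⇒≡ : ∀ {g h} → g ∈ G → h ∈ G → g ≋ h → g ≡ h
    G-≋⇒≡ g∈G h∈G g≋h with i , refl ← ∈⇒lookup g∈G | j , refl ← ∈⇒lookup h∈G =
      cong (lookup G) (lookup-≋-injective (proj₂ (proj₁ G-dp)) i j g≋h)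

    classify : ∀ {g} → g ∈ G → ∃[ q ] (g ≋ dpClause q)
    classify g∈G with G-member⁻ g∈G
    ... | inj₁ (D , D∈F , v∉D , g≋D) with q , _ , q↦D ← vFree-position D∈F v∉D = q , ≋-respʳ-≡ g≋D (sym q↦D)
    ... | inj₂ g-res with C , C∈F , ve∈C , g≋R ← resolvent-shape g-res
                     with q , _ , q↦R ← main-position C∈F ve∈C = q , ≋-respʳ-≡ g≋R (sym q↦R)

    vFree-member : ∀ j → lookup VFree j ∈ F × ¬ Occurs v (lookup VFree j)
    vFree-member j = ∈-filter⁻ (¬? ∘ Occurs? v) (∈-lookup j)

    main-member : ∀ j → lookup Mains j ∈ F × (v , e) ∈ lookup Mains j
    main-member j = ∈-filter⁻ ((v , e) ∈?_) (∈-lookup j)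

    module Forward (mu : MU dom F) where

      dpClause-in-G : ∀ q → ∃[ h ] (h ∈ G × dpClause q ≋ h)
      dpClause-in-G q with split q
      ... | inj₁ (j , refl) with D∈F , v∉D ← vFree-member j =
        G-member⁺ (inj₁ (_ , D∈F , v∉D , ≋-respʳ-≡ ≋-refl (dpClause-vFree j)))
      ... | inj₂ (j , refl) with C∈F , ve∈C ← main-member j =
        G-member⁺ (inj₂ (subst (IsResolvent dom v F) (sym (dpClause-main j)) (MU⇒resolventOf-isResolvent mu C∈F ve∈C)))

      main-≉-vFree : ∀ i j → ¬ (resolventOf (lookup Mains i) ≋ lookup VFree j)
      main-≉-vFree i j = resolventOf-≉-vFree mu (proj₁ (main-member i)) (proj₂ (main-member i))
                                               (proj₁ (vFree-member j)) (proj₂ (vFree-member j))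

      dpClause-≋-injective : ∀ p q → dpClause p ≋ dpClause q → p ≡ q
      dpClause-≋-injective p q p≋q with split p | split q
      ... | inj₁ (i , refl) | inj₁ (j , refl) =
        cong (_↑ˡ k) (lookup-≋-injective (AP.filter⁺ (¬? ∘ Occurs? v) (proj₂ F-wf)) i j
                        (subst₂ _≋_ (dpClause-vFree i) (dpClause-vFree j) p≋q))
      ... | inj₁ (i , refl) | inj₂ (j , refl) =
        ⊥-elim (main-≉-vFree j i (subst₂ _≋_ (dpClause-main j) (dpClause-vFree i) (≋-sym p≋q)))
      ... | inj₂ (i , refl) | inj₁ (j , refl) =
        ⊥-elim (main-≉-vFree i j (subst₂ _≋_ (dpClause-main i) (dpClause-vFree j) p≋q))
      ... | inj₂ (i , refl) | inj₂ (j , refl) =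
        cong (nv ↑ʳ_) (lookup-≋-injective (AP.filter⁺ ((v , e) ∈?_) (proj₂ F-wf)) i j
          (≋-respʳ-≡ ≋-refl (resolventOf-≋-injective mu (proj₁ (main-member i)) (proj₂ (main-member i))
            (proj₁ (main-member j)) (proj₂ (main-member j))
            (subst₂ _≋_ (dpClause-main i) (dpClause-main j) p≋q))))

      size≤c : nv + k ≤ c G
      size≤c = injective⇒≤ {f = position-in-G} position-in-G-injective
        where
        position-in-G : Fin (nv + k) → Fin (c G)
        position-in-G q = proj₁ (∈⇒lookup (proj₁ (proj₂ (dpClause-in-G q))))
        dpClause≋position : ∀ q → dpClause q ≋ lookup G (position-in-G q)
        dpClause≋position q with _ , h∈G , q≋h ← dpClause-in-G q = ≋-respʳ-≡ q≋h (proj₂ (∈⇒lookup h∈G))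
        position-in-G-injective : Injective _≡_ _≡_ position-in-G
        position-in-G-injective {p} {q} eq = dpClause-≋-injective p q
          (≋-trans (≋-respʳ-≡ (dpClause≋position p) (cong (lookup G) eq)) (≋-sym (dpClause≋position q)))

      G-unsat : ¬ Satisfiable dom G
      G-unsat (ψ , ψ⊨G) = proj₁ mu F-sat
        where
        sat-DP : ∀ {C} → InDP C → SatClause ψ C
        sat-DP C∈DP with _ , h∈G , C≋h ← G-member⁺ C∈DP = satClause-≋ (≋-sym C≋h) (All.lookup ψ⊨G h∈G)
        vFree-sat : ∀ {C} → C ∈ F → ⊤ → ¬ Occurs v C → SatClause ψ C
        vFree-sat {C} C∈F _ v∉C = sat-DP (inj₁ (C , C∈F , v∉C , ≋-refl))
        resolvent-sat : ∀ {C} → C ∈ F → ⊤ → (v , e) ∈ C → SatClause ψ (resolventOf C)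
        resolvent-sat C∈F _ ve∈C = sat-DP (inj₂ (MU⇒resolventOf-isResolvent mu C∈F ve∈C))
        F-sat : Satisfiable dom F
        F-sat with φ , φ⊨F ← extend (λ _ → ⊤) vFree-sat resolvent-sat = φ , All.tabulate (λ C∈F → φ⊨F C∈F tt)

      G-satisfiedExcept : ∀ {g₀} → g₀ ∈ G → ∃[ φ ] SatisfiedExcept φ G g₀
      G-satisfiedExcept {g₀} g₀∈G with G-member⁻ g₀∈G
      ... | inj₁ (D₀ , D₀∈F , v∉D₀ , g₀≋D₀) with φ , satExcept , _ ← MU⇒satisfiedExcept mu D₀∈F =
        φ , sat
        where
        sat : SatisfiedExcept φ G g₀
        sat g∈G g≢g₀ with G-member⁻ g∈G
        ... | inj₁ (D , D∈F , _ , g≋D) with D ≟C D₀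
        ...   | yes refl = ⊥-elim (g≢g₀ (G-≋⇒≡ g∈G g₀∈G (≋-trans g≋D (≋-sym g₀≋D₀))))
        ...   | no  D≢D₀ = satClause-≋ (≋-sym g≋D) (satExcept D∈F D≢D₀)
        sat g∈G g≢g₀ | inj₂ g-res with C , C∈F , ve∈C , g≋R ← resolvent-shape g-res =
          satClause-≋ (≋-sym g≋R) (sat⇒sat-resolventOf (λ P∈F v∈P → satExcept P∈F λ { refl → v∉D₀ v∈P })
                                                        C∈F ve∈C)
      ... | inj₂ g₀-res with C₀ , C₀∈F , ve∈C₀ , g₀≋R₀ ← resolvent-shape g₀-res
                        with φ , satExcept , C₀-false ← MU⇒satisfiedExcept mu C₀∈F =
        φ , sat
        where
        sat : SatisfiedExcept φ G g₀
        sat g∈G g≢g₀ with G-member⁻ g∈G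
        ... | inj₁ (D , D∈F , v∉D , g≋D) =
          satClause-≋ (≋-sym g≋D) (satExcept D∈F λ { refl → v∉D (lose ve∈C₀ refl) })
        ... | inj₂ g-res with C , C∈F , ve∈C , g≋R ← resolvent-shape g-res | C ≟C C₀
        ...   | yes refl = ⊥-elim (g≢g₀ (G-≋⇒≡ g∈G g₀∈G (≋-trans g≋R (≋-sym g₀≋R₀))))
        ...   | no  C≢C₀ =
          satClause-≋ (≋-sym g≋R) (sat-resolventOf-except-main satExcept C₀-false ve∈C₀ C∈F ve∈C C≢C₀)

      G-MU : MU dom G
      G-MU = satisfiedExcept⇒MU G-unsat G-satisfiedExcept

    F-sat⇒G-sat : ∀ {φ} → All (SatClause φ) F → All (SatClause φ) G
    F-sat⇒G-sat {φ} φ⊨F = All.tabulate sat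
      where
      sat : ∀ {g} → g ∈ G → SatClause φ g
      sat g∈G with G-member⁻ g∈G
      ... | inj₁ (D , D∈F , _ , g≋D) = satClause-≋ (≋-sym g≋D) (All.lookup φ⊨F D∈F)
      ... | inj₂ g-res with C , C∈F , ve∈C , g≋R ← resolvent-shape g-res =
        satClause-≋ (≋-sym g≋R) (sat⇒sat-resolventOf (λ P∈F _ → All.lookup φ⊨F P∈F) C∈F ve∈C)

    module Backward (size≤ : nv + k ≤ c G) (G-mu : MU dom G) where

      class : Fin (c G) → Fin (nv + k)
      class i = proj₁ (classify (∈-lookup i))

      lookup≋class : ∀ i → lookup G i ≋ dpClause (class i)
      lookup≋class i = proj₂ (classify (∈-lookup i))

      class-injective : Injective _≡_ _≡_ class
      class-injective {i} {j} eq = lookup-≋-injective (proj₂ (proj₁ G-dp)) i j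
        (≋-trans (≋-respʳ-≡ (lookup≋class i) (cong dpClause eq)) (≋-sym (lookup≋class j)))

      class-surjective : ∀ q → ∃[ i ] class i ≡ q
      class-surjective = injective⇒surjective class class-injective size≤

      satisfied-avoiding : ∀ p → ∃[ ψ ] (∀ q → q ≢ p → SatClause ψ (dpClause q))
      satisfied-avoiding p with i₀ , refl ← class-surjective p
                           with ψ , satExcept , _ ← MU⇒satisfiedExcept G-mu (∈-lookup {xs = G} i₀) =
        ψ , sat
        where
        sat : ∀ q → q ≢ class i₀ → SatClause ψ (dpClause q)
        sat q q≢p with i , refl ← class-surjective q =
          satClause-≋ (lookup≋class i) (satExcept (∈-lookup i) i≢i₀)
          where
          i≢i₀ : lookup G i ≢ lookup G i₀
          i≢i₀ eq = q≢p (cong class (lookup-≋-injective (proj₂ (proj₁ G-dp)) i i₀ (≋-respʳ-≡ ≋-refl eq)))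

      satisfied-avoiding-position : ∀ {P p} → Position P p → ∃[ ψ ]
        ((∀ {C} → C ∈ F → C ≢ P → ¬ Occurs v C → SatClause ψ C) ×
         (∀ {C} → C ∈ F → C ≢ P → (v , e) ∈ C → SatClause ψ (resolventOf C)))
      satisfied-avoiding-position {P} {p} P↦p with ψ , ψ⊨ ← satisfied-avoiding p =
        ψ , vFree-sat , resolvent-sat
        where
        vFree-sat : ∀ {C} → C ∈ F → C ≢ P → ¬ Occurs v C → SatClause ψ C
        vFree-sat C∈F C≢P v∉C with q , C↦q , q↦C ← vFree-position C∈F v∉C =
          subst (SatClause ψ) q↦C (ψ⊨ q λ { refl → C≢P (position-unique C↦q P↦p) })
        resolvent-sat : ∀ {C} → C ∈ F → C ≢ P → (v , e) ∈ C → SatClause ψ (resolventOf C)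
        resolvent-sat C∈F C≢P ve∈C with q , C↦q , q↦R ← main-position C∈F ve∈C =
          subst (SatClause ψ) q↦R (ψ⊨ q λ { refl → C≢P (position-unique C↦q P↦p) })

      F-satisfiedExcept : 0 < k → ∀ {P} → P ∈ F → ∃[ φ ] SatisfiedExcept φ F P
      F-satisfiedExcept k>0 {P} P∈F with Occurs? v P
      ... | no v∉P with _ , P↦p , _ ← vFree-position P∈F v∉P
                   with _ , vFree-sat , resolvent-sat ← satisfied-avoiding-position P↦p =
        extend (_≢ P) vFree-sat resolvent-sat
      ... | yes v∈P with a , va∈P ← v-value v∈P | a ≟ e
      ...   | yes refl with _ , P↦p , _ ← main-position P∈F va∈P
                       with _ , vFree-sat , resolvent-sat ← satisfied-avoiding-position P↦p =
        extend (_≢ P) vFree-sat resolvent-sat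
      ...   | no a≢e with M∈F , ve∈M ← main-member (fromℕ< k>0)
                     with _ , M↦p , _ ← main-position M∈F ve∈M
                     with _ , vFree-sat , _ ← satisfied-avoiding-position M↦p =
        satisfiedExcept-side (λ C∈F v∉C → vFree-sat C∈F (λ { refl → v∉C (lose ve∈M refl) }) v∉C) P∈F va∈P a≢e

      F-MU : 0 < k → MU dom F
      F-MU k>0 = satisfiedExcept⇒MU (λ (φ , φ⊨F) → proj₁ G-mu (φ , F-sat⇒G-sat φ⊨F)) (F-satisfiedExcept k>0)

lemma1p6p1 : (dom : Domains) → (∀ v → 0 < dom v) →
    (F : ClauseSet) → IsClauseSet dom F →
    (v : Var) → Singular dom v F →
    (G : ClauseSet) → IsDP dom v F G →
    MU dom F ⇔ (NonDegenerated dom v F G × MU dom G)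
lemma1p6p1 dom _ F F-wf v (e , e<n , main-occ , side-occ≡1) G G-dp = mk⇔
  (λ F-mu → Equivalence.from nonDegenerated⇔size (Forward.size≤c F-mu) , Forward.G-MU F-mu)
  (λ (nonDeg , G-mu) → Backward.F-MU (Equivalence.to nonDegenerated⇔size nonDeg) G-mu main-occ)
  where
  open SingularVariable F-wf v e<n side-occ≡1
  open DP G-dp
  nonDegenerated⇔size : NonDegenerated dom v F G ⇔ nv + k ≤ c G
  nonDegenerated⇔size = nonDegenerated⇔ main-occ G
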